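{- For any heap implementation in the canonical framework and any sequence of heap operations starting with no heaps, the number of final links plus the number of delete-mins is at most the number of insertions.
   Context: Canonical heap framework: a heap holding items with keys from a totally ordered set is either empty or a single heap-ordered rooted tree whose nodes are the items. A link of two roots makes the root of smaller key (the winner, ties arbitrary) the parent of the other (the loser); a cut removes a child from its parent. Operations: make-heap creates an empty heap; find-min returns the root; insert$(H,e)$ links $e$ with the root of $H$ if nonempty, else $e$ becomes the root; meld links the roots of two nonempty heaps; decrease-key$(H,e,k)$ sets the key of $e$ to $k$ and, if $e$ is not the root, cuts $e$ from its parent and links $e$ with the root; delete-min deletes the root (cutting all its child links) and repeatedly links pairs of the resulting roots until only one remains. A final link is a link that is never cut during the sequence. -}

module Defs where

open import Level using (Level; _⊔_)
open import Data.Nat using (ℕ; zero; suc; _≡ᵇ_; _<_)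
open import Data.Bool using (Bool; true; false; not; if_then_else_)
open import Data.Maybe using (Maybe; just; nothing)
open import Data.Product using (_×_; _,_)
open import Data.List using (List; []; _∷_; filterᵇ; upTo; length; foldl)
open import Data.List.Relation.Binary.Permutation.Propositional using (_↭_)
open import Relation.Binary.Bundles using (TotalOrder)
open import Relation.Binary.PropositionalEquality using (_≡_)
open import Relation.Nullary using (¬_)

update : ∀ {a} {A : Set a} → (ℕ → A) → ℕ → A → ℕ → A
update f i v j = if j ≡ᵇ i then v else f j

module Framework {c ℓ₁ ℓ₂ : Level} (O : TotalOrder c ℓ₁ ℓ₂) where
  open TotalOrder O renaming (Carrier to Key)

  -- Items are numbered 0,1,2,... in order of insertion; heaps are numbered
  -- 0,1,2,... in order of creation by make-heap; links are numbered
  -- 0,1,2,... in the order they are performed.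
  record State : Set c where
    field
      nItems   : ℕ
      key      : ℕ → Key
      parent   : ℕ → Maybe (ℕ × ℕ) -- (parent item , id of the link making it the parent)
      nHeaps   : ℕ
      heapLive : ℕ → Bool          -- heap still exists (not consumed by a meld)
      root     : ℕ → Maybe ℕ       -- root of each heap (nothing = empty heap)
      nLinks   : ℕ
      isCut    : ℕ → Bool
  open State public

  init : Key → State
  init k₀ = record
    { nItems = 0 ; key = λ _ → k₀ ; parent = λ _ → nothing
    ; nHeaps = 0 ; heapLive = λ _ → false ; root = λ _ → nothing
    ; nLinks = 0 ; isCut = λ _ → false }

  setRoot : State → ℕ → Maybe ℕ → State
  setRoot s h r = record s { root = update (root s) h r }

  attach : State → (w l : ℕ) → State
  attach s w l = record s
    { parent = update (parent s) l (just (w , nLinks s))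
    ; nLinks = suc (nLinks s) }

  data Link (s : State) (a b : ℕ) : ℕ → State → Set (c ⊔ ℓ₂) where
    win-a : key s a ≤ key s b → Link s a b a (attach s a b)
    win-b : key s b ≤ key s a → Link s a b b (attach s b a)

  cutItem : State → ℕ → State
  cutItem s e with parent s e
  ... | nothing = s
  ... | just (p , i) = record s
    { parent = update (parent s) e nothing
    ; isCut  = update (isCut s) i true }

  data InTree (s : State) : ℕ → ℕ → Set where
    here  : ∀ {r} → parent s r ≡ nothing → InTree s r r
    there : ∀ {e p i r} → parent s e ≡ just (p , i) → InTree s p r → InTree s e r

  isChildOf : ℕ → Maybe (ℕ × ℕ) → Bool
  isChildOf r nothing = false
  isChildOf r (just (p , _)) = p ≡ᵇ r

  children : State → ℕ → List ℕ
  children s r = filterᵇ (λ x → isChildOf r (parent s x)) (upTo (nItems s))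

  -- repeatedly link pairs (chosen arbitrarily) of the roots until one remains
  data Pairing : State → List ℕ → Maybe ℕ → State → Set (c ⊔ ℓ₂) where
    none : ∀ {s} → Pairing s [] nothing s
    one  : ∀ {s x} → Pairing s (x ∷ []) (just x) s
    pair : ∀ {s s₁ s₂ xs a b ys w res} →
           xs ↭ (a ∷ b ∷ ys) → Link s a b w s₁ →
           Pairing s₁ (w ∷ ys) res s₂ → Pairing s xs res s₂

  data Op : Set c where
    makeHeap    : Op
    findMin     : (h : ℕ) → Op
    insert      : (h : ℕ) → (k : Key) → Op
    meld        : (h₁ h₂ : ℕ) → Op                 -- result in h₁; h₂ ceases to exist
    decreaseKey : (h : ℕ) → (e : ℕ) → (k : Key) → Op
    deleteMin   : (h : ℕ) → Op

  newItem : State → Key → State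
  newItem s k = record s { nItems = suc (nItems s) ; key = update (key s) (nItems s) k }

  data Step (s : State) : Op → State → Set (c ⊔ ℓ₁ ⊔ ℓ₂) where
    make-heap : Step s makeHeap (record s
      { nHeaps = suc (nHeaps s)
      ; heapLive = update (heapLive s) (nHeaps s) true
      ; root = update (root s) (nHeaps s) nothing })
    find-min : ∀ {h} → heapLive s h ≡ true → Step s (findMin h) s
    insert-empty : ∀ {h k} → heapLive s h ≡ true → root s h ≡ nothing →
      Step s (insert h k) (setRoot (newItem s k) h (just (nItems s)))
    insert-link : ∀ {h k r w s₁} → heapLive s h ≡ true → root s h ≡ just r →
      Link (newItem s k) (nItems s) r w s₁ →
      Step s (insert h k) (setRoot s₁ h (just w))
    meld-emptyˡ : ∀ {h₁ h₂} → ¬ h₁ ≡ h₂ → heapLive s h₁ ≡ true → heapLive s h₂ ≡ true →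
      root s h₁ ≡ nothing →
      Step s (meld h₁ h₂) (record (setRoot s h₁ (root s h₂)) { heapLive = update (heapLive s) h₂ false })
    meld-emptyʳ : ∀ {h₁ h₂} → ¬ h₁ ≡ h₂ → heapLive s h₁ ≡ true → heapLive s h₂ ≡ true →
      root s h₂ ≡ nothing →
      Step s (meld h₁ h₂) (record s { heapLive = update (heapLive s) h₂ false })
    meld-link : ∀ {h₁ h₂ r₁ r₂ w s₁} → ¬ h₁ ≡ h₂ → heapLive s h₁ ≡ true → heapLive s h₂ ≡ true →
      root s h₁ ≡ just r₁ → root s h₂ ≡ just r₂ → Link s r₁ r₂ w s₁ →
      Step s (meld h₁ h₂) (record (setRoot s₁ h₁ (just w)) { heapLive = update (heapLive s₁) h₂ false })
    decrease-key-root : ∀ {h e k} → heapLive s h ≡ true → root s h ≡ just e → k ≤ key s e →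
      Step s (decreaseKey h e k) (record s { key = update (key s) e k })
    decrease-key-cut : ∀ {h e k r p i w s₁} → heapLive s h ≡ true → root s h ≡ just r →
      InTree s e r → k ≤ key s e → parent s e ≡ just (p , i) →
      Link (cutItem (record s { key = update (key s) e k }) e) e r w s₁ →
      Step s (decreaseKey h e k) (setRoot s₁ h (just w))
    delete-min : ∀ {h r res s₁} → heapLive s h ≡ true → root s h ≡ just r →
      Pairing (foldl cutItem s (children s r)) (children s r) res s₁ →
      Step s (deleteMin h) (setRoot s₁ h res)

  data Exec : State → List Op → State → Set (c ⊔ ℓ₁ ⊔ ℓ₂) where
    [] : ∀ {s} → Exec s [] s
    _∷_ : ∀ {s s₁ s₂ op ops} → Step s op s₁ → Exec s₁ ops s₂ → Exec s (op ∷ ops) s₂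

  isInsert : Op → Bool
  isInsert (insert _ _) = true
  isInsert _ = false

  isDeleteMin : Op → Bool
  isDeleteMin (deleteMin _) = true
  isDeleteMin _ = false

  #insertions : List Op → ℕ
  #insertions ops = length (filterᵇ isInsert ops)

  #deleteMins : List Op → ℕ
  #deleteMins ops = length (filterᵇ isDeleteMin ops)

  -- links never cut during the sequence (cut flags are never reset)
  #finalLinks : State → ℕ
  #finalLinks s = length (filterᵇ (λ i → not (isCut s i)) (upTo (nLinks s)))

{-# OPTIONS --safe #-}
-- Let Φ be the number of uncut links plus the number of nonempty heaps. Every item in a heap
-- is a root or hangs from its parent by one uncut link, so Φ counts the items in heaps: it
-- rises by one on insert, falls by one on delete-min (the k children of the root are cut and
-- relinked with k - 1 links, or the heap empties when k = 0), and is unchanged otherwise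
-- (meld trades a nonempty heap for a link, decrease-key a cut link for a new one). Final
-- links are uncut, so #finalLinks + #deleteMins ≤ Φ + #deleteMins = #insertions.
-- Counting cuts exactly needs the invariant ValidLinks: parent pointers carry distinct uncut
-- links, so cutting a child removes exactly one uncut link.
module Submission where

open import Defs
open import Data.Bool using (Bool; true; false; not; _∧_; T)
open import Data.Empty using (⊥-elim)
open import Data.List using (List; []; _∷_; length; filterᵇ; upTo; foldl; _++_)
open import Data.List.Properties using (upTo-∷ʳ; length-++; filter-++)
open import Data.List.Relation.Binary.Permutation.Propositional.Properties using (↭-length)
open import Data.List.Relation.Unary.All as All using (All; []; _∷_)
open import Data.List.Relation.Unary.All.Properties using (all-filter)
open import Data.List.Relation.Unary.AllPairs using ([]; _∷_)
open import Data.List.Relation.Unary.Unique.Propositional using (Unique)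
open import Data.List.Relation.Unary.Unique.Propositional.Properties using (filter⁺; upTo⁺)
open import Data.Maybe using (Maybe; just; nothing; is-just)
open import Data.Maybe.Properties using (just-injective)
open import Data.Nat using (ℕ; zero; suc; _+_; _≤_; _<_; _≟_; _≡ᵇ_; s≤s⁻¹)
open import Data.Nat.Properties
open import Algebra.Properties.CommutativeSemigroup +-commutativeSemigroup using (x∙yz≈xz∙y; xy∙z≈xz∙y; interchange)
open import Data.Product using (_×_; _,_; proj₂; ∃)
open import Data.Sum using (_⊎_; inj₁; inj₂; [_,_])
open import Function using (_∘_)
open import Relation.Binary.Bundles using (TotalOrder)
open import Relation.Binary.PropositionalEquality using (_≡_; _≢_; refl; sym; trans; cong; cong₂; subst; module ≡-Reasoning)
open import Relation.Nullary using (yes; no)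
open import Relation.Nullary.Decidable using (T?)

toℕ : Bool → ℕ
toℕ false = 0
toℕ true  = 1

countBelow : (ℕ → Bool) → ℕ → ℕ
countBelow p zero    = 0
countBelow p (suc n) = countBelow p n + toℕ (p n)

countBelow-cong : ∀ {p q} n → (∀ {j} → j < n → p j ≡ q j) → countBelow p n ≡ countBelow q n
countBelow-cong zero    p≗q = refl
countBelow-cong (suc n) p≗q =
  cong₂ _+_ (countBelow-cong n (p≗q ∘ m<n⇒m<1+n)) (cong toℕ (p≗q (n<1+n n)))

countBelow-change : ∀ {p q i} n → i < n → (∀ {j} → j ≢ i → p j ≡ q j) →
                    countBelow q n + toℕ (p i) ≡ countBelow p n + toℕ (q i)
countBelow-change {p} {q} {i} (suc n) i<1+n p≗q with i ≟ n
... | yes refl = begin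
  countBelow q n + toℕ (q n) + toℕ (p n) ≡⟨ xy∙z≈xz∙y (countBelow q n) _ _ ⟩
  countBelow q n + toℕ (p n) + toℕ (q n) ≡⟨ cong (λ c → c + toℕ (p n) + toℕ (q n)) q≡p ⟩
  countBelow p n + toℕ (p n) + toℕ (q n) ∎
  where
  open ≡-Reasoning
  q≡p : countBelow q n ≡ countBelow p n
  q≡p = sym (countBelow-cong n (λ j<n → p≗q (<⇒≢ j<n)))
... | no i≢n = begin
  countBelow q n + toℕ (q n) + toℕ (p i) ≡⟨ xy∙z≈xz∙y (countBelow q n) _ _ ⟩
  countBelow q n + toℕ (p i) + toℕ (q n) ≡⟨ cong (_+ toℕ (q n)) (countBelow-change n (≤∧≢⇒< (s≤s⁻¹ i<1+n) i≢n) p≗q) ⟩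
  countBelow p n + toℕ (q i) + toℕ (q n) ≡⟨ xy∙z≈xz∙y (countBelow p n) _ _ ⟩
  countBelow p n + toℕ (q n) + toℕ (q i) ≡⟨ cong (λ b → countBelow p n + toℕ b + toℕ (q i)) (p≗q (i≢n ∘ sym)) ⟨
  countBelow p n + toℕ (p n) + toℕ (q i) ∎
  where open ≡-Reasoning

length-filterᵇ-∷ : ∀ {a} {A : Set a} (p : A → Bool) x xs →
                   length (filterᵇ p (x ∷ xs)) ≡ toℕ (p x) + length (filterᵇ p xs)
length-filterᵇ-∷ p x xs with p x
... | true  = refl
... | false = refl

length-filterᵇ-upTo : ∀ p n → length (filterᵇ p (upTo n)) ≡ countBelow p n
length-filterᵇ-upTo p zero    = refl
length-filterᵇ-upTo p (suc n) = begin
  length (filterᵇ p (upTo (suc n)))                         ≡⟨ cong (length ∘ filterᵇ p) (upTo-∷ʳ n) ⟨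
  length (filterᵇ p (upTo n ++ n ∷ []))                     ≡⟨ cong length (filter-++ (T? ∘ p) (upTo n) (n ∷ [])) ⟩
  length (filterᵇ p (upTo n) ++ filterᵇ p (n ∷ []))         ≡⟨ length-++ (filterᵇ p (upTo n)) ⟩
  length (filterᵇ p (upTo n)) + length (filterᵇ p (n ∷ [])) ≡⟨ cong₂ _+_ (length-filterᵇ-upTo p n) (length-filterᵇ-∷ p n []) ⟩
  countBelow p n + (toℕ (p n) + 0)                          ≡⟨ cong (countBelow p n +_) (+-identityʳ _) ⟩
  countBelow p n + toℕ (p n)                                ∎
  where open ≡-Reasoning

update-≡ : ∀ {a} {A : Set a} (f : ℕ → A) i v → update f i v i ≡ v
update-≡ f i v with i ≡ᵇ i | ≡⇒≡ᵇ i i refl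
... | true  | _  = refl
... | false | ()

update-≢ : ∀ {a} {A : Set a} (f : ℕ → A) {i j} v → j ≢ i → update f i v j ≡ f j
update-≢ f {i} {j} v j≢i with j ≡ᵇ i | ≡ᵇ⇒≡ j i
... | true  | j≡i = ⊥-elim (j≢i (j≡i _))
... | false | _   = refl

SupportBelow : (ℕ → Bool) → ℕ → Set
SupportBelow f n = ∀ {j} → f j ≡ true → j < n

supportBelow-weaken : ∀ {f m n} → m ≤ n → SupportBelow f m → SupportBelow f n
supportBelow-weaken m≤n f<m fj = <-≤-trans (f<m fj) m≤n

supportBelow-update : ∀ {f n i b} → (b ≡ true → i < n) → SupportBelow f n →
                      SupportBelow (update f i b) n
supportBelow-update {f} {i = i} {b} i<n f<n {j} fj with j ≟ i
... | yes refl = i<n (trans (sym (update-≡ f j b)) fj)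
... | no j≢i   = f<n (trans (sym (update-≢ f b j≢i)) fj)

record ValidLinks (parent : ℕ → Maybe (ℕ × ℕ)) (isCut : ℕ → Bool) (n : ℕ) : Set where
  field
    link<       : ∀ {e p i} → parent e ≡ just (p , i) → i < n
    link-uncut  : ∀ {e p i} → parent e ≡ just (p , i) → isCut i ≡ false
    link-unique : ∀ {e e′ p p′ i} → parent e ≡ just (p , i) → parent e′ ≡ just (p′ , i) → e ≡ e′
    cut<        : SupportBelow isCut n

module _ {parent isCut n} (valid : ValidLinks parent isCut n) where
  open ValidLinks valid

  fresh-uncut : isCut n ≡ false
  fresh-uncut with isCut n in cutₙ
  ... | true  = ⊥-elim (<-irrefl refl (cut< cutₙ))
  ... | false = refl

  validLinks-attach : ∀ w l → ValidLinks (update parent l (just (w , n))) isCut (suc n)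
  validLinks-attach w l = record
    { link<       = λ eq → [ (λ (_ , i≡n) → ≤-reflexive (cong suc i≡n)) , (λ (_ , eq) → m<n⇒m<1+n (link< eq)) ] (origin eq)
    ; link-uncut  = λ eq → [ (λ (_ , i≡n) → trans (cong isCut i≡n) fresh-uncut) , (λ (_ , eq) → link-uncut eq) ] (origin eq)
    ; link-unique = unique
    ; cut<        = supportBelow-weaken (n≤1+n n) cut<
    }
    where
    parent′ = update parent l (just (w , n))
    origin : ∀ {e p i} → parent′ e ≡ just (p , i) → (e ≡ l × i ≡ n) ⊎ (e ≢ l × parent e ≡ just (p , i))
    origin {e} eq with e ≟ l
    ... | yes refl = inj₁ (refl , sym (cong proj₂ (just-injective (trans (sym (update-≡ parent e _)) eq))))
    ... | no e≢l   = inj₂ (e≢l , trans (sym (update-≢ parent _ e≢l)) eq)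
    unique : ∀ {e e′ p p′ i} → parent′ e ≡ just (p , i) → parent′ e′ ≡ just (p′ , i) → e ≡ e′
    unique eq eq′ with origin eq | origin eq′
    ... | inj₁ (refl , _)   | inj₁ (refl , _)    = refl
    ... | inj₁ (_ , refl)   | inj₂ (_ , eq′)     = ⊥-elim (<-irrefl refl (link< eq′))
    ... | inj₂ (_ , eq)     | inj₁ (_ , refl)    = ⊥-elim (<-irrefl refl (link< eq))
    ... | inj₂ (_ , eq)     | inj₂ (_ , eq′)     = link-unique eq eq′

  validLinks-detach : ∀ {e p i} → parent e ≡ just (p , i) →
                      ValidLinks (update parent e nothing) (update isCut i true) n
  validLinks-detach {e} {p} {i} parentₑ = record
    { link<       = link< ∘ proj₂ ∘ origin
    ; link-uncut  = uncut
    ; link-unique = λ eq eq′ → link-unique (proj₂ (origin eq)) (proj₂ (origin eq′))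
    ; cut<        = supportBelow-update (λ _ → link< parentₑ) cut<
    }
    where
    parent′ = update parent e nothing
    origin : ∀ {e′ p′ i′} → parent′ e′ ≡ just (p′ , i′) → e′ ≢ e × parent e′ ≡ just (p′ , i′)
    origin {e′} eq with e′ ≟ e
    ... | yes refl with () ← trans (sym (update-≡ parent e′ nothing)) eq
    ... | no e′≢e = e′≢e , trans (sym (update-≢ parent _ e′≢e)) eq
    uncut : ∀ {e′ p′ i′} → parent′ e′ ≡ just (p′ , i′) → update isCut i true i′ ≡ false
    uncut {i′ = i′} eq with origin eq | i′ ≟ i
    ... | e′≢e , eq′ | yes refl = ⊥-elim (e′≢e (link-unique eq′ parentₑ))
    ... | _    , eq′ | no i′≢i  = trans (update-≢ isCut true i′≢i) (link-uncut eq′)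

  uncut-attach : countBelow (not ∘ isCut) (suc n) ≡ countBelow (not ∘ isCut) n + 1
  uncut-attach rewrite fresh-uncut = refl

  uncut-detach : ∀ {e p i} → parent e ≡ just (p , i) →
                 countBelow (not ∘ update isCut i true) n + 1 ≡ countBelow (not ∘ isCut) n
  uncut-detach {i = i} parentₑ = begin
    countBelow uncut′ n + 1                  ≡⟨ cong (λ b → countBelow uncut′ n + toℕ (not b)) (link-uncut parentₑ) ⟨
    countBelow uncut′ n + toℕ (uncut i)      ≡⟨ countBelow-change n (link< parentₑ) (cong not ∘ sym ∘ update-≢ isCut true) ⟩
    countBelow uncut n + toℕ (uncut′ i)      ≡⟨ cong (λ b → countBelow uncut n + toℕ (not b)) (update-≡ isCut i true) ⟩
    countBelow uncut n + 0                   ≡⟨ +-identityʳ _ ⟩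
    countBelow uncut n                       ∎
    where
    open ≡-Reasoning
    uncut uncut′ : ℕ → Bool
    uncut  = not ∘ isCut
    uncut′ = not ∘ update isCut i true

foldl-preserves : ∀ {a b p} {A : Set a} {B : Set b} (P : A → Set p) {f : A → B → A} →
                  (∀ {x} y → P x → P (f x y)) → ∀ {x} ys → P x → P (foldl f x ys)
foldl-preserves P pres []       px = px
foldl-preserves P pres (y ∷ ys) px = foldl-preserves P pres ys (pres y px)

module Accounting {c ℓ₁ ℓ₂} (O : TotalOrder c ℓ₁ ℓ₂) where
  open Framework O

  Valid : State → Set
  Valid s = ValidLinks (parent s) (isCut s) (nLinks s)

  LiveBelow : State → Set
  LiveBelow s = SupportBelow (heapLive s) (nHeaps s)

  WellFormed : State → Set
  WellFormed s = Valid s × LiveBelow s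

  uncutLinks : State → ℕ
  uncutLinks s = countBelow (not ∘ isCut s) (nLinks s)

  occupied : State → ℕ → Bool
  occupied s h = heapLive s h ∧ is-just (root s h)

  nonemptyHeaps : State → ℕ
  nonemptyHeaps s = countBelow (occupied s) (nHeaps s)

  potential : State → ℕ
  potential s = uncutLinks s + nonemptyHeaps s

  heaps : State → (ℕ → Bool) × (ℕ → Maybe ℕ) × ℕ
  heaps s = heapLive s , root s , nHeaps s

  liveBelow-heaps : ∀ s t → heaps t ≡ heaps s → LiveBelow s → LiveBelow t
  liveBelow-heaps s t eq = subst (λ (live , _ , n) → SupportBelow live n) (sym eq)

  nonemptyHeaps-setRoot-heaps : ∀ s t h r → heaps t ≡ heaps s →
                                nonemptyHeaps (setRoot t h r) ≡ nonemptyHeaps (setRoot s h r)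
  nonemptyHeaps-setRoot-heaps s t h r = cong (λ (live , rt , n) → countBelow (λ j → live j ∧ is-just (update rt h r j)) n)

  link-attaches : ∀ {s a b w s₁} → Link s a b w s₁ → ∃ λ l → s₁ ≡ attach s w l
  link-attaches (win-a _) = _ , refl
  link-attaches (win-b _) = _ , refl

  cutItem-heaps : ∀ s e → heaps (cutItem s e) ≡ heaps s
  cutItem-heaps s e with parent s e
  ... | nothing = refl
  ... | just _  = refl

  cutItem-valid : ∀ {s} e → Valid s → Valid (cutItem s e)
  cutItem-valid {s} e valid with parent s e in parentₑ
  ... | nothing = valid
  ... | just _  = validLinks-detach valid parentₑ

  cutItem-parent-≢ : ∀ s {e x} → x ≢ e → parent (cutItem s e) x ≡ parent s x
  cutItem-parent-≢ s {e} x≢e with parent s e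
  ... | nothing = refl
  ... | just _  = update-≢ (parent s) nothing x≢e

  uncutLinks-cutItem : ∀ {s e p i} → Valid s → parent s e ≡ just (p , i) →
                       uncutLinks (cutItem s e) + 1 ≡ uncutLinks s
  uncutLinks-cutItem {s} {e} valid parentₑ with parent s e in eq
  ... | just _ = uncut-detach valid eq

  Linked : State → ℕ → Set
  Linked s x = ∃ λ link → parent s x ≡ just link

  uncutLinks-cutAll : ∀ {s} xs → Valid s → Unique xs → All (Linked s) xs →
                      uncutLinks (foldl cutItem s xs) + length xs ≡ uncutLinks s
  uncutLinks-cutAll             []       valid []           []                      = +-identityʳ _
  uncutLinks-cutAll {s} (x ∷ xs) valid (x∉xs ∷ unique) ((_ , parentₓ) ∷ linked) = begin
    uncutLinks (foldl cutItem s′ xs) + suc (length xs) ≡⟨ +-suc _ (length xs) ⟩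
    suc (uncutLinks (foldl cutItem s′ xs) + length xs) ≡⟨ cong suc (uncutLinks-cutAll xs (cutItem-valid x valid) unique linked′) ⟩
    suc (uncutLinks s′)                                ≡⟨ +-comm 1 _ ⟩
    uncutLinks s′ + 1                                  ≡⟨ uncutLinks-cutItem valid parentₓ ⟩
    uncutLinks s                                       ∎
    where
    open ≡-Reasoning
    s′ = cutItem s x
    linked′ : All (Linked s′) xs
    linked′ = All.zipWith (λ (x≢y , link , parentᵧ) → link , trans (cutItem-parent-≢ s (x≢y ∘ sym)) parentᵧ)
                          (x∉xs , linked)

  pairing-valid : ∀ {s xs r s₁} → Valid s → Pairing s xs r s₁ → Valid s₁
  pairing-valid valid none = valid
  pairing-valid valid one  = valid
  pairing-valid valid (pair _ link rest) with link-attaches link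
  ... | l , refl = pairing-valid (validLinks-attach valid _ l) rest

  pairing-heaps : ∀ {s xs r s₁} → Pairing s xs r s₁ → heaps s₁ ≡ heaps s
  pairing-heaps none = refl
  pairing-heaps one  = refl
  pairing-heaps (pair _ link rest) with link-attaches link
  ... | _ , refl = pairing-heaps rest

  uncutLinks-pairing : ∀ {s xs r s₁} → Valid s → Pairing s xs r s₁ →
                       uncutLinks s₁ + toℕ (is-just r) ≡ uncutLinks s + length xs
  uncutLinks-pairing valid none = refl
  uncutLinks-pairing valid one  = refl
  uncutLinks-pairing {s} {xs} {r} {s₂} valid (pair {ys = ys} {w = w} xs↭abys link rest) with link-attaches link
  ... | l , refl = begin
    uncutLinks s₂ + toℕ (is-just r)               ≡⟨ uncutLinks-pairing (validLinks-attach valid w l) rest ⟩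
    uncutLinks (attach s w l) + suc (length ys)   ≡⟨ cong (_+ suc (length ys)) (uncut-attach valid) ⟩
    uncutLinks s + 1 + suc (length ys)            ≡⟨ +-assoc (uncutLinks s) 1 _ ⟩
    uncutLinks s + suc (suc (length ys))          ≡⟨ cong (uncutLinks s +_) (↭-length xs↭abys) ⟨
    uncutLinks s + length xs                      ∎
    where open ≡-Reasoning

  addHeap : State → State
  addHeap s = record s
    { nHeaps   = suc (nHeaps s)
    ; heapLive = update (heapLive s) (nHeaps s) true
    ; root     = update (root s) (nHeaps s) nothing }

  retire : State → ℕ → State
  retire s h = record s { heapLive = update (heapLive s) h false }

  nonemptyHeaps-addHeap : ∀ s → nonemptyHeaps (addHeap s) ≡ nonemptyHeaps s
  nonemptyHeaps-addHeap s rewrite update-≡ (heapLive s) (nHeaps s) true | update-≡ (root s) (nHeaps s) nothing =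
    trans (+-identityʳ _) (countBelow-cong (nHeaps s) λ j<n →
      cong₂ (λ live r → live ∧ is-just r) (update-≢ (heapLive s) true (<⇒≢ j<n)) (update-≢ (root s) nothing (<⇒≢ j<n)))

  nonemptyHeaps-setRoot : ∀ s {h old} new → root s h ≡ old → h < nHeaps s → heapLive s h ≡ true →
                          nonemptyHeaps (setRoot s h new) + toℕ (is-just old) ≡ nonemptyHeaps s + toℕ (is-just new)
  nonemptyHeaps-setRoot s {h} new refl h<n liveₕ = begin
    countBelow q n + toℕ (is-just (root s h))  ≡⟨ cong (λ b → countBelow q n + toℕ (b ∧ is-just (root s h))) liveₕ ⟨
    countBelow q n + toℕ (occupied s h)        ≡⟨ countBelow-change n h<n agree ⟩
    countBelow (occupied s) n + toℕ (q h)      ≡⟨ cong₂ (λ b r → countBelow (occupied s) n + toℕ (b ∧ is-just r)) liveₕ (update-≡ (root s) h new) ⟩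
    countBelow (occupied s) n + toℕ (is-just new) ∎
    where
    open ≡-Reasoning
    n = nHeaps s
    q = occupied (setRoot s h new)
    agree : ∀ {j} → j ≢ h → occupied s j ≡ q j
    agree j≢h = cong (λ r → heapLive s _ ∧ is-just r) (sym (update-≢ (root s) new j≢h))

  nonemptyHeaps-setRoot-just : ∀ s {h x} y → root s h ≡ just x → nonemptyHeaps (setRoot s h (just y)) ≡ nonemptyHeaps s
  nonemptyHeaps-setRoot-just s {h} y rootₕ = countBelow-cong (nHeaps s) (λ {j} _ → same j)
    where
    same : ∀ j → occupied (setRoot s h (just y)) j ≡ occupied s j
    same j with j ≟ h
    ... | yes refl rewrite update-≡ (root s) j (just y) | rootₕ = refl
    ... | no j≢h   rewrite update-≢ (root s) (just y) j≢h = refl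

  nonemptyHeaps-retire : ∀ s {h old} → root s h ≡ old → h < nHeaps s → heapLive s h ≡ true →
                         nonemptyHeaps (retire s h) + toℕ (is-just old) ≡ nonemptyHeaps s
  nonemptyHeaps-retire s {h} refl h<n liveₕ = begin
    countBelow q n + toℕ (is-just (root s h))  ≡⟨ cong (λ b → countBelow q n + toℕ (b ∧ is-just (root s h))) liveₕ ⟨
    countBelow q n + toℕ (occupied s h)        ≡⟨ countBelow-change n h<n agree ⟩
    countBelow (occupied s) n + toℕ (q h)      ≡⟨ cong (λ b → countBelow (occupied s) n + toℕ (b ∧ is-just (root s h))) (update-≡ (heapLive s) h false) ⟩
    countBelow (occupied s) n + 0              ≡⟨ +-identityʳ _ ⟩
    countBelow (occupied s) n                  ∎
    where
    open ≡-Reasoning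
    n = nHeaps s
    q = occupied (retire s h)
    agree : ∀ {j} → j ≢ h → occupied s j ≡ q j
    agree j≢h = cong (λ live → live ∧ is-just (root s _)) (sym (update-≢ (heapLive s) false j≢h))

  nonemptyHeaps-transferRoot : ∀ s {h₁ h₂} → h₁ ≢ h₂ → root s h₁ ≡ nothing →
                               h₁ < nHeaps s → heapLive s h₁ ≡ true → h₂ < nHeaps s → heapLive s h₂ ≡ true →
                               nonemptyHeaps (retire (setRoot s h₁ (root s h₂)) h₂) ≡ nonemptyHeaps s
  nonemptyHeaps-transferRoot s {h₁} {h₂} h₁≢h₂ root₁ h₁<n live₁ h₂<n live₂ = +-cancelʳ-≡ _ _ _ (begin
    nonemptyHeaps (retire t h₂) + toℕ (is-just (root s h₂)) ≡⟨ nonemptyHeaps-retire t (update-≢ (root s) _ (h₁≢h₂ ∘ sym)) h₂<n live₂ ⟩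
    nonemptyHeaps t                                         ≡⟨ +-identityʳ _ ⟨
    nonemptyHeaps t + 0                                     ≡⟨ nonemptyHeaps-setRoot s (root s h₂) root₁ h₁<n live₁ ⟩
    nonemptyHeaps s + toℕ (is-just (root s h₂))             ∎)
    where
    open ≡-Reasoning
    t = setRoot s h₁ (root s h₂)

  cutAll-heaps : ∀ s xs → heaps (foldl cutItem s xs) ≡ heaps s
  cutAll-heaps s xs = foldl-preserves (λ t → heaps t ≡ heaps s) (λ {t} e eq → trans (cutItem-heaps t e) eq) xs refl

  isChildOf-linked : ∀ r {m} → T (isChildOf r m) → ∃ λ link → m ≡ just link
  isChildOf-linked r {just link} _ = link , refl

  children-unique : ∀ s r → Unique (children s r)
  children-unique s r = filter⁺ (T? ∘ λ x → isChildOf r (parent s x)) (upTo⁺ (nItems s))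

  children-linked : ∀ s r → All (Linked s) (children s r)
  children-linked s r = All.map (λ {x} → isChildOf-linked r {parent s x})
                                (all-filter (T? ∘ λ x → isChildOf r (parent s x)) (upTo (nItems s)))

  step-wellFormed : ∀ {s op s′} → WellFormed s → Step s op s′ → WellFormed s′
  step-wellFormed (valid , live<) make-heap = valid , supportBelow-update (λ _ → n<1+n _) (supportBelow-weaken (n≤1+n _) live<)
  step-wellFormed wf (find-min _)         = wf
  step-wellFormed wf (insert-empty _ _)   = wf
  step-wellFormed (valid , live<) (insert-link _ _ link) with link-attaches link
  ... | l , refl = validLinks-attach valid _ l , live<
  step-wellFormed (valid , live<) (meld-emptyˡ _ _ _ _) = valid , supportBelow-update (λ ()) live<
  step-wellFormed (valid , live<) (meld-emptyʳ _ _ _ _) = valid , supportBelow-update (λ ()) live<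
  step-wellFormed (valid , live<) (meld-link _ _ _ _ _ link) with link-attaches link
  ... | l , refl = validLinks-attach valid _ l , supportBelow-update (λ ()) live<
  step-wellFormed wf (decrease-key-root _ _ _) = wf
  step-wellFormed {s} (valid , live<) (decrease-key-cut {e = e} {k = k} _ _ _ _ _ link) with link-attaches link
  ... | l , refl = validLinks-attach (cutItem-valid e valid) _ l , liveBelow-heaps s (cutItem s′ e) (cutItem-heaps s′ e) live<
    where s′ = record s { key = update (key s) e k }
  step-wellFormed {s} (valid , live<) (delete-min {r = r} {s₁ = s₁} _ _ pairing) =
    pairing-valid (foldl-preserves Valid cutItem-valid (children s r) valid) pairing ,
    liveBelow-heaps s s₁ (trans (pairing-heaps pairing) (cutAll-heaps s (children s r))) live<

  potential-change : ∀ s s′ {a b c d} → uncutLinks s′ + a ≡ uncutLinks s + b → nonemptyHeaps s′ + c ≡ nonemptyHeaps s + d →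
                potential s′ + (a + c) ≡ potential s + (b + d)
  potential-change s s′ {a} {b} {c} {d} eqU eqH = begin
    uncutLinks s′ + nonemptyHeaps s′ + (a + c)   ≡⟨ interchange (uncutLinks s′) _ a c ⟩
    uncutLinks s′ + a + (nonemptyHeaps s′ + c)   ≡⟨ cong₂ _+_ eqU eqH ⟩
    uncutLinks s + b + (nonemptyHeaps s + d)     ≡⟨ interchange (uncutLinks s) b _ d ⟩
    uncutLinks s + nonemptyHeaps s + (b + d)     ∎
    where open ≡-Reasoning

  potential-deleteRoot : ∀ s s₁ {h x res} → LiveBelow s → heapLive s h ≡ true → root s h ≡ just x →
                         uncutLinks s₁ + toℕ (is-just res) ≡ uncutLinks s → heaps s₁ ≡ heaps s →
                         potential (setRoot s₁ h res) + 1 ≡ potential s + 0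
  potential-deleteRoot s s₁ {h} {res = just y} live< liveₕ rootₕ eqU heaps≡ =
    potential-change s (setRoot s₁ h _) (trans eqU (sym (+-identityʳ _)))
      (cong (_+ 0) (trans (nonemptyHeaps-setRoot-heaps s s₁ h (just y) heaps≡) (nonemptyHeaps-setRoot-just s y rootₕ)))
  potential-deleteRoot s s₁ {h} {res = nothing} live< liveₕ rootₕ eqU heaps≡ =
    potential-change s (setRoot s₁ h _) (trans eqU (sym (+-identityʳ _)))
      (trans (cong (_+ 1) (nonemptyHeaps-setRoot-heaps s s₁ h nothing heaps≡)) (nonemptyHeaps-setRoot s nothing rootₕ (live< liveₕ) liveₕ))

  step-potential : ∀ {s op s′} → WellFormed s → Step s op s′ →
                   potential s′ + toℕ (isDeleteMin op) ≡ potential s + toℕ (isInsert op)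
  step-potential {s} _ make-heap = cong (λ n → uncutLinks s + n + 0) (nonemptyHeaps-addHeap s)
  step-potential _ (find-min _) = refl
  step-potential {s} (_ , live<) (insert-empty {h} liveₕ rootₕ) =
    potential-change s (setRoot s h (just (nItems s))) refl (nonemptyHeaps-setRoot s (just _) rootₕ (live< liveₕ) liveₕ)
  step-potential {s} (valid , _) (insert-link {h} {w = w} _ rootₕ link) with link-attaches link
  ... | l , refl = potential-change s (setRoot (attach s w l) h (just w)) (trans (+-identityʳ _) (uncut-attach valid))
                                   (cong (_+ 0) (nonemptyHeaps-setRoot-just s w rootₕ))
  step-potential {s} (_ , live<) (meld-emptyˡ h₁≢h₂ live₁ live₂ root₁) =
    cong (λ n → uncutLinks s + n + 0) (nonemptyHeaps-transferRoot s h₁≢h₂ root₁ (live< live₁) live₁ (live< live₂) live₂)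
  step-potential {s} (_ , live<) (meld-emptyʳ _ _ live₂ root₂) =
    cong (λ n → uncutLinks s + n + 0) (trans (sym (+-identityʳ _)) (nonemptyHeaps-retire s root₂ (live< live₂) live₂))
  step-potential {s} (valid , live<) (meld-link {h₁} {h₂} {w = w} h₁≢h₂ _ live₂ root₁ root₂ link) with link-attaches link
  ... | l , refl = cong (_+ 0) (begin
    uncutLinks (attach s w l) + nonemptyHeaps s′ ≡⟨ cong (_+ nonemptyHeaps s′) (uncut-attach valid) ⟩
    uncutLinks s + 1 + nonemptyHeaps s′          ≡⟨ +-assoc (uncutLinks s) 1 _ ⟩
    uncutLinks s + suc (nonemptyHeaps s′)        ≡⟨ cong (uncutLinks s +_) (+-comm 1 _) ⟩
    uncutLinks s + (nonemptyHeaps s′ + 1)        ≡⟨ cong (uncutLinks s +_) (trans retired rerooted) ⟩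
    uncutLinks s + nonemptyHeaps s               ∎)
    where
    open ≡-Reasoning
    t = setRoot (attach s w l) h₁ (just w)
    s′ = retire t h₂
    retired : nonemptyHeaps s′ + 1 ≡ nonemptyHeaps t
    retired = nonemptyHeaps-retire t (trans (update-≢ (root s) _ (h₁≢h₂ ∘ sym)) root₂) (live< live₂) live₂
    rerooted : nonemptyHeaps t ≡ nonemptyHeaps s
    rerooted = nonemptyHeaps-setRoot-just s w root₁
  step-potential _ (decrease-key-root _ _ _) = refl
  step-potential {s} (valid , _) (decrease-key-cut {h} {e} {k} {w = w} _ rootₕ _ _ parentₑ link) with link-attaches link
  ... | l , refl = cong (_+ 0) (cong₂ _+_
      (trans (uncut-attach (cutItem-valid e valid)) (uncutLinks-cutItem valid parentₑ))
      (trans (nonemptyHeaps-setRoot-heaps s′ (cutItem s′ e) h (just w) (cutItem-heaps s′ e)) (nonemptyHeaps-setRoot-just s w rootₕ)))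
    where s′ = record s { key = update (key s) e k }
  step-potential {s} (valid , live<) (delete-min {r = r} {s₁ = s₁} liveₕ rootₕ pairing) =
    potential-deleteRoot s s₁ live< liveₕ rootₕ
      (trans (uncutLinks-pairing (foldl-preserves Valid cutItem-valid cs valid) pairing)
             (uncutLinks-cutAll cs valid (children-unique s r) (children-linked s r)))
      (trans (pairing-heaps pairing) (cutAll-heaps s cs))
    where cs = children s r

  exec-potential : ∀ {s ops s′} → WellFormed s → Exec s ops s′ →
                   potential s′ + #deleteMins ops ≡ potential s + #insertions ops
  exec-potential wf [] = refl
  exec-potential {s} {op ∷ ops} {s′} wf (_∷_ {s₁ = s₁} step rest) = begin
    potential s′ + #deleteMins (op ∷ ops)  ≡⟨ cong (potential s′ +_) (length-filterᵇ-∷ isDeleteMin op ops) ⟩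
    potential s′ + (del + #deleteMins ops) ≡⟨ x∙yz≈xz∙y (potential s′) del _ ⟩
    potential s′ + #deleteMins ops + del   ≡⟨ cong (_+ del) (exec-potential (step-wellFormed wf step) rest) ⟩
    potential s₁ + #insertions ops + del   ≡⟨ xy∙z≈xz∙y (potential s₁) _ del ⟩
    potential s₁ + del + #insertions ops   ≡⟨ cong (_+ #insertions ops) (step-potential wf step) ⟩
    potential s + ins + #insertions ops    ≡⟨ +-assoc (potential s) ins _ ⟩
    potential s + (ins + #insertions ops)  ≡⟨ cong (potential s +_) (length-filterᵇ-∷ isInsert op ops) ⟨
    potential s + #insertions (op ∷ ops)   ∎
    where
    open ≡-Reasoning
    del = toℕ (isDeleteMin op)
    ins = toℕ (isInsert op)

  init-wellFormed : ∀ k₀ → WellFormed (init k₀)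
  init-wellFormed k₀ = record { link< = λ () ; link-uncut = λ () ; link-unique = λ () ; cut< = λ () } , λ ()

lemma4p2 : ∀ {c ℓ₁ ℓ₂} (O : TotalOrder c ℓ₁ ℓ₂) (k₀ : TotalOrder.Carrier O)
           (ops : List (Framework.Op O)) (s : Framework.State O) →
           Framework.Exec O (Framework.init O k₀) ops s →
           Framework.#finalLinks O s + Framework.#deleteMins O ops ≤ Framework.#insertions O ops
lemma4p2 O k₀ ops s exec = begin
  #finalLinks s + #deleteMins ops         ≡⟨ cong (_+ #deleteMins ops) (length-filterᵇ-upTo _ (nLinks s)) ⟩
  uncutLinks s + #deleteMins ops          ≤⟨ +-monoˡ-≤ (#deleteMins ops) (m≤m+n (uncutLinks s) _) ⟩
  potential s + #deleteMins ops           ≡⟨ exec-potential (init-wellFormed k₀) exec ⟩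
  potential (init k₀) + #insertions ops   ≡⟨⟩
  #insertions ops                         ∎
  where
  open Framework O
  open Accounting O
  open ≤-Reasoning
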